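{- For any p-strings $x$ and $y$ with $\mathrm{fce}(x)=\mathrm{fce}(y)$, we have $\langle x[2..]\rangle<\langle y[2..]\rangle$ if and only if $\langle x\rangle<\langle y\rangle$.
   Context: $\Sigma_s$ (s-symbols) and $\Sigma_p$ (p-symbols) are disjoint alphabets; a p-string is a string over $\Sigma_s\cup\Sigma_p$. Strings are 1-indexed; $w[i..]$ is the suffix starting at $i$, $w[..i]$ the prefix of length $i$. $\infty$ is a symbol larger than every integer; the alphabet $\Sigma_s\cup\{1,2,\dots\}\cup\{\infty\}$ is totally ordered with every s-symbol smaller than every integer and $\infty$; strings are compared lexicographically. The p-encoding $\langle w\rangle$ of a p-string $w$ is the string of length $|w|$ with $\langle w\rangle[i]=w[i]$ if $w[i]\in\Sigma_s$; $\langle w\rangle[i]=\infty$ if $w[i]\in\Sigma_p$ does not occur in $w[..i-1]$; and $\langle w\rangle[i]=i-j$ otherwise, where $j$ is the largest position in $[1..i-1]$ with $w[j]=w[i]$. $|w|_p$ is the number of distinct p-symbols in $w$; $\mathsf{select}_c(w,i)$ is the position of the $i$-th occurrence of $c$ in $w$. For a nonempty p-string $w$, $\mathrm{fce}(w)=w[1]$ if $w[1]\in\Sigma_s$, and otherwise $\mathrm{fce}(w)=|w[..h+1]|_p$ where $h+1=\min\{|w|,\mathsf{select}_{w[1]}(w,2)\}$; $\mathrm{fce}(\varepsilon)=\$$, the smallest s-symbol. -}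

module Defs where

open import Level using (0ℓ)
open import Data.Nat using (ℕ; zero; suc) renaming (_<_ to _<ℕ_)
open import Data.List using (List; []; _∷_; length; mapMaybe; deduplicate; drop)
open import Data.Maybe using (Maybe; just; nothing)
open import Data.Sum using (_⊎_; inj₁; inj₂)
open import Data.Empty using (⊥)
open import Data.Unit using (⊤)
open import Relation.Binary.Core using (Rel)
open import Relation.Binary.Definitions using (DecidableEquality)
open import Relation.Binary.PropositionalEquality using (_≡_)
open import Relation.Nullary using (yes; no)
open import Data.List.Relation.Binary.Lex.Strict using (Lex-<)

data Enc (S : Set) : Set where
  sym : S → Enc S
  num : ℕ → Enc S
  inf : Enc S

-- Values of fce: the sentinel $ (smallest s-symbol, not occurring in p-strings),
-- an s-symbol, or a natural number.
data FCE (S : Set) : Set where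
  dollar : FCE S
  fsym   : S → FCE S
  fnum   : ℕ → FCE S

-- Parameterised by: decidable equality on Σ_p, and the (strict) order on Σ_s.
-- A p-string is a List (S ⊎ P): inj₁ = s-symbol, inj₂ = p-symbol.
module PString {S P : Set} (_≟_ : DecidableEquality P) (_<ₛ_ : Rel S 0ℓ) where

  PStr : Set
  PStr = List (S ⊎ P)

  -- distance back to the nearest previous occurrence of p,
  -- given the prefix in reverse order (nothing if no previous occurrence)
  dist : P → List (S ⊎ P) → Maybe ℕ
  dist p [] = nothing
  dist p (inj₁ _ ∷ r) = Data.Maybe.map suc (dist p r)
  dist p (inj₂ q ∷ r) with p ≟ q
  ... | yes _ = just 1
  ... | no  _ = Data.Maybe.map suc (dist p r)

  toEnc : Maybe ℕ → Enc S
  toEnc nothing  = inf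
  toEnc (just n) = num n

  -- encode the remainder, given the already-read prefix in reverse
  encAux : List (S ⊎ P) → PStr → List (Enc S)
  encAux rev [] = []
  encAux rev (inj₁ s ∷ w) = sym s ∷ encAux (inj₁ s ∷ rev) w
  encAux rev (inj₂ p ∷ w) = toEnc (dist p rev) ∷ encAux (inj₂ p ∷ rev) w

  ⟨_⟩ : PStr → List (Enc S)
  ⟨ w ⟩ = encAux [] w

  isP : S ⊎ P → Maybe P
  isP (inj₁ _) = nothing
  isP (inj₂ p) = just p

  ∣_∣ₚ : PStr → ℕ
  ∣ w ∣ₚ = length (deduplicate _≟_ (mapMaybe isP w))

  upToNext : P → PStr → PStr
  upToNext p [] = []
  upToNext p (inj₁ s ∷ r) = inj₁ s ∷ upToNext p r
  upToNext p (inj₂ q ∷ r) with p ≟ q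
  ... | yes _ = inj₂ q ∷ []
  ... | no  _ = inj₂ q ∷ upToNext p r

  -- fce(w); for w[1] = p, the prefix w[..h+1] with h+1 = min{|w|, select_p(w,2)}
  fce : PStr → FCE S
  fce [] = dollar
  fce (inj₁ s ∷ w) = fsym s
  fce (inj₂ p ∷ w) = fnum ∣ inj₂ p ∷ upToNext p w ∣ₚ

  _<ₑ_ : Enc S → Enc S → Set
  sym a <ₑ sym b = a <ₛ b
  sym _ <ₑ num _ = ⊤
  sym _ <ₑ inf   = ⊤
  num _ <ₑ sym _ = ⊥
  num m <ₑ num n = m <ℕ n
  num _ <ₑ inf   = ⊤
  inf   <ₑ _     = ⊥

  _<ₗ_ : List (Enc S) → List (Enc S) → Set
  _<ₗ_ = Lex-< _≡_ _<ₑ_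

  suffix2 : PStr → PStr
  suffix2 = drop 1

-- Write x = c x′ and y = c′ y′ with fce(x) = fce(y).  If c = c′ is an s-symbol, the
-- encodings of x and y are those of x′ and y′ behind a common letter.  If c and c′ are
-- p-symbols, ⟨x⟩ = ∞ ⟨c x′⟩[2..], and ⟨c x′⟩[2..] arises from ⟨x′⟩ by replacing the ∞
-- at the first occurrence of c in x′ by its position k, which is larger than every
-- back-reference that can occur at position k.  That occurrence is the (fce(x))-th ∞ of
-- ⟨x′⟩, so the same ∞ is replaced in x′ and y′, and such a replacement neither creates
-- nor destroys a lexicographic inequality.
module Submission where

open import Defs
open import Level using (0ℓ)
open import Function using (_∘_; id)
open import Function.Bundles using (_⇔_; mk⇔; Equivalence)
open import Function.Construct.Composition using (_⇔-∘_)
open import Data.Nat using (ℕ; suc; _+_; _≤_; _<_; z≤n; s≤s)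
open import Data.Nat.Properties using (<-irrefl; <-asym; +-comm; +-suc; +-identityʳ; suc-injective)
open import Data.List using (List; []; _∷_; [_]; _++_; _∷ʳ_; length; deduplicate; filter; mapMaybe)
open import Data.List.Properties using (filter-++; filter-accept; filter-reject; ∷ʳ-++; ++-identityʳ; length-++)
open import Data.List.Membership.Propositional using (_∈_; _∉_)
open import Data.List.Membership.Propositional.Properties using (∈-++⁺ˡ; ∈-++⁺ʳ; ∈-++⁻)
open import Data.List.Relation.Unary.Any using (here; there)
open import Data.List.Relation.Binary.Lex.Strict using (base; halt; this; next)
open import Data.Maybe using (just; nothing)
open import Data.Maybe.Relation.Unary.All using (All; just; nothing)
import Data.Maybe.Relation.Unary.All as MaybeAll
open import Data.Maybe.Relation.Unary.All.Properties using (gmap)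
open import Data.Sum using (_⊎_; inj₁; inj₂)
import Data.Sum as Sum
open import Data.Sum.Properties using (inj₂-injective)
open import Data.Empty using (⊥-elim)
open import Data.Unit using (tt)
open import Relation.Nullary using (yes; no; ¬_; ¬?)
open import Relation.Unary using (Decidable)
open import Relation.Binary.Core using (Rel)
open import Relation.Binary.Structures using (IsStrictTotalOrder)
open import Relation.Binary.Definitions using (DecidableEquality)
open import Relation.Binary.PropositionalEquality
  using (_≡_; refl; trans; cong; subst; module ≡-Reasoning) renaming (sym to ≡-sym)

module _ {A : Set} (_≟_ : DecidableEquality A) where
  open import Data.List.Membership.DecPropositional _≟_ using (_∈?_)
  open ≡-Reasoning

  deduplicate-∷ʳ-∉ : ∀ xs {a} → a ∉ xs → deduplicate _≟_ (xs ∷ʳ a) ≡ deduplicate _≟_ xs ∷ʳ a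
  deduplicate-∷ʳ-∉ []       _   = refl
  deduplicate-∷ʳ-∉ (m ∷ xs) {a} a∉ = cong (m ∷_) (begin
    filter m≢? (deduplicate _≟_ (xs ∷ʳ a)) ≡⟨ cong (filter m≢?) (deduplicate-∷ʳ-∉ xs (a∉ ∘ there)) ⟩
    filter m≢? (ys ∷ʳ a)                   ≡⟨ filter-++ m≢? ys [ a ] ⟩
    filter m≢? ys ++ filter m≢? [ a ]      ≡⟨ cong (filter m≢? ys ++_) (filter-accept m≢? (a∉ ∘ here ∘ ≡-sym)) ⟩
    filter m≢? ys ∷ʳ a                     ∎)
    where
    m≢? : Decidable (λ y → ¬ m ≡ y)
    m≢? = ¬? ∘ (m ≟_)
    ys : List A
    ys = deduplicate _≟_ xs

  deduplicate-∷ʳ-∈ : ∀ xs {a} → a ∈ xs → deduplicate _≟_ (xs ∷ʳ a) ≡ deduplicate _≟_ xs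
  deduplicate-∷ʳ-∈ (m ∷ xs) (there a∈xs) = cong (λ ys → m ∷ filter (¬? ∘ (m ≟_)) ys) (deduplicate-∷ʳ-∈ xs a∈xs)
  deduplicate-∷ʳ-∈ (m ∷ xs) (here refl) with m ∈? xs
  ... | yes m∈xs = cong (λ ys → m ∷ filter (¬? ∘ (m ≟_)) ys) (deduplicate-∷ʳ-∈ xs m∈xs)
  ... | no  m∉xs = cong (m ∷_) (begin
    filter m≢? (deduplicate _≟_ (xs ∷ʳ m)) ≡⟨ cong (filter m≢?) (deduplicate-∷ʳ-∉ xs m∉xs) ⟩
    filter m≢? (ys ∷ʳ m)                   ≡⟨ filter-++ m≢? ys [ m ] ⟩
    filter m≢? ys ++ filter m≢? [ m ]      ≡⟨ cong (filter m≢? ys ++_) (filter-reject m≢? (λ m≢m → m≢m refl)) ⟩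
    filter m≢? ys ++ []                    ≡⟨ ++-identityʳ _ ⟩
    filter m≢? ys                          ∎)
    where
    m≢? : Decidable (λ y → ¬ m ≡ y)
    m≢? = ¬? ∘ (m ≟_)
    ys : List A
    ys = deduplicate _≟_ xs

  distinct : List A → ℕ
  distinct xs = length (deduplicate _≟_ xs)

  distinct-∷ʳ-∈ : ∀ xs {a} → a ∈ xs → distinct (xs ∷ʳ a) ≡ distinct xs
  distinct-∷ʳ-∈ xs a∈xs = cong length (deduplicate-∷ʳ-∈ xs a∈xs)

  distinct-∷ʳ-∉ : ∀ xs {a} → a ∉ xs → distinct (xs ∷ʳ a) ≡ suc (distinct xs)
  distinct-∷ʳ-∉ xs {a} a∉xs = begin
    length (deduplicate _≟_ (xs ∷ʳ a)) ≡⟨ cong length (deduplicate-∷ʳ-∉ xs a∉xs) ⟩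
    length (deduplicate _≟_ xs ∷ʳ a)   ≡⟨ length-++ (deduplicate _≟_ xs) ⟩
    distinct xs + 1                    ≡⟨ +-comm (distinct xs) 1 ⟩
    suc (distinct xs)                  ∎

module _ {S P : Set} (_≟_ : DecidableEquality P) (_<ₛ_ : Rel S 0ℓ) where
  open PString _≟_ _<ₛ_
  open Equivalence using (to; from)

  dist-∷-cong : ∀ c {r r′} → (∀ q → dist q r ≡ dist q r′) → ∀ q → dist q (c ∷ r) ≡ dist q (c ∷ r′)
  dist-∷-cong (inj₁ s) r≈r′ q = cong (Data.Maybe.map suc) (r≈r′ q)
  dist-∷-cong (inj₂ p) r≈r′ q with q ≟ p
  ... | yes _ = refl
  ... | no  _ = cong (Data.Maybe.map suc) (r≈r′ q)

  encAux-cong : ∀ w {r r′} → (∀ q → dist q r ≡ dist q r′) → encAux r w ≡ encAux r′ w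
  encAux-cong []           r≈r′ = refl
  encAux-cong (inj₁ s ∷ w) {r} {r′} r≈r′ =
    cong (sym s ∷_) (encAux-cong w (dist-∷-cong (inj₁ s) {r} {r′} r≈r′))
  encAux-cong (inj₂ p ∷ w) {r} {r′} r≈r′ rewrite r≈r′ p =
    cong (_ ∷_) (encAux-cong w (dist-∷-cong (inj₂ p) {r} {r′} r≈r′))

  ⟨⟩-∷-sSym : ∀ s w → ⟨ inj₁ s ∷ w ⟩ ≡ sym s ∷ ⟨ w ⟩
  ⟨⟩-∷-sSym s w = cong (sym s ∷_) (encAux-cong w (λ _ → refl))

  dist-just⇒∈ : ∀ {a m} r → dist a r ≡ just m → inj₂ a ∈ r
  dist-just⇒∈ {a} (inj₁ s ∷ r) e with dist a r in e′
  ... | just _ = there (dist-just⇒∈ r e′)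
  dist-just⇒∈ {a} (inj₂ q ∷ r) e with a ≟ q
  ... | yes refl = here refl
  ... | no  _ with dist a r in e′
  ...   | just _ = there (dist-just⇒∈ r e′)

  dist-nothing⇒∉ : ∀ {a} r → dist a r ≡ nothing → inj₂ a ∉ r
  dist-nothing⇒∉ {a} (inj₁ s ∷ r) e (there a∈r) with dist a r in e′
  ... | nothing = dist-nothing⇒∉ r e′ a∈r
  dist-nothing⇒∉ {a} (inj₂ q ∷ r) e a∈ with a ≟ q | a∈
  ... | no a≢q | here a≡q = a≢q (inj₂-injective a≡q)
  ... | no _   | there a∈r with dist a r in e′
  ...   | nothing = dist-nothing⇒∉ r e′ a∈r

  dist-∷-fresh : ∀ {p q} r → dist p r ≡ nothing → ¬ p ≡ q → dist p (inj₂ q ∷ r) ≡ nothing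
  dist-∷-fresh {p} {q} r e p≢q with p ≟ q
  ... | yes p≡q = ⊥-elim (p≢q p≡q)
  ... | no  _   = cong (Data.Maybe.map suc) e

  dist-∷ʳ-≢ : ∀ {q p} r → ¬ q ≡ p → dist q (r ∷ʳ inj₂ p) ≡ dist q r
  dist-∷ʳ-≢ {q} {p} [] q≢p with q ≟ p
  ... | yes q≡p = ⊥-elim (q≢p q≡p)
  ... | no  _   = refl
  dist-∷ʳ-≢ (inj₁ s ∷ r) q≢p = cong (Data.Maybe.map suc) (dist-∷ʳ-≢ r q≢p)
  dist-∷ʳ-≢ {q} (inj₂ t ∷ r) q≢p with q ≟ t
  ... | yes _ = refl
  ... | no  _ = cong (Data.Maybe.map suc) (dist-∷ʳ-≢ r q≢p)

  dist-∷ʳ-fresh : ∀ {p} r → dist p r ≡ nothing → dist p (r ∷ʳ inj₂ p) ≡ just (suc (length r))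
  dist-∷ʳ-fresh {p} [] _ with p ≟ p
  ... | yes _   = refl
  ... | no  p≢p = ⊥-elim (p≢p refl)
  dist-∷ʳ-fresh {p} (inj₁ s ∷ r) e with dist p r in e′
  ... | nothing = cong (Data.Maybe.map suc) (dist-∷ʳ-fresh r e′)
  dist-∷ʳ-fresh {p} (inj₂ t ∷ r) e with p ≟ t
  ... | no _ with dist p r in e′
  ...   | nothing = cong (Data.Maybe.map suc) (dist-∷ʳ-fresh r e′)

  dist-∷-∷ʳ-shadowed : ∀ p r q → dist q (inj₂ p ∷ (r ∷ʳ inj₂ p)) ≡ dist q (inj₂ p ∷ r)
  dist-∷-∷ʳ-shadowed p r q with q ≟ p
  ... | yes _   = refl
  ... | no  q≢p = cong (Data.Maybe.map suc) (dist-∷ʳ-≢ r q≢p)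

  dist-≤-length : ∀ q r → All (_≤ length r) (dist q r)
  dist-≤-length q []           = nothing
  dist-≤-length q (inj₁ s ∷ r) = gmap s≤s (dist-≤-length q r)
  dist-≤-length q (inj₂ p ∷ r) with q ≟ p
  ... | yes _ = just (s≤s z≤n)
  ... | no  _ = gmap s≤s (dist-≤-length q r)

  -- A back-reference at position k of an encoding is smaller than k.
  data ValidFrom : ℕ → List (Enc S) → Set where
    []  : ∀ {n} → ValidFrom n []
    sym : ∀ {n s a} → ValidFrom (suc n) a → ValidFrom n (sym s ∷ a)
    num : ∀ {n m a} → m < n → ValidFrom (suc n) a → ValidFrom n (num m ∷ a)
    inf : ∀ {n a} → ValidFrom (suc n) a → ValidFrom n (inf ∷ a)

  validFrom-tail : ∀ {n e a} → ValidFrom n (e ∷ a) → ValidFrom (suc n) a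
  validFrom-tail (sym v)   = v
  validFrom-tail (num _ v) = v
  validFrom-tail (inf v)   = v

  validFrom-toEnc : ∀ {n a mb} → All (_< n) mb → ValidFrom (suc n) a → ValidFrom n (toEnc mb ∷ a)
  validFrom-toEnc nothing    v = inf v
  validFrom-toEnc (just m<n) v = num m<n v

  encAux-valid : ∀ r w → ValidFrom (suc (length r)) (encAux r w)
  encAux-valid r []           = []
  encAux-valid r (inj₁ s ∷ w) = sym (encAux-valid (inj₁ s ∷ r) w)
  encAux-valid r (inj₂ p ∷ w) =
    validFrom-toEnc (MaybeAll.map s≤s (dist-≤-length p r)) (encAux-valid (inj₂ p ∷ r) w)

  data Finite : Enc S → Set where
    sym : ∀ {s} → Finite (sym s)
    num : ∀ {m} → Finite (num m)

  finite<ₑinf : ∀ {e} → Finite e → e <ₑ inf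
  finite<ₑinf sym = tt
  finite<ₑinf num = tt

  finite<ₑposition : ∀ {n e a} → Finite e → ValidFrom n (e ∷ a) → e <ₑ num n
  finite<ₑposition sym _           = tt
  finite<ₑposition num (num m<n _) = m<n

  position≮ₑfinite : ∀ {n e a} → Finite e → ValidFrom n (e ∷ a) → ¬ num n <ₑ e
  position≮ₑfinite sym _           ()
  position≮ₑfinite num (num m<n _) n<m = <-asym m<n n<m

  -- Resolves c n a a′: a′ is a, read from position n, with its (c+1)-st ∞ (say at
  -- position k) replaced by the back-reference k to a symbol just before position n.
  data Resolves : ℕ → ℕ → List (Enc S) → List (Enc S) → Set where
    []   : ∀ {c n} → Resolves c n [] []
    keep : ∀ {c n e a a′} → Finite e → Resolves c (suc n) a a′ → Resolves c n (e ∷ a) (e ∷ a′)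
    skip : ∀ {c n a a′} → Resolves c (suc n) a a′ → Resolves (suc c) n (inf ∷ a) (inf ∷ a′)
    hit  : ∀ {n a} → Resolves 0 n (inf ∷ a) (num n ∷ a)

  resolves-preserves-<ₗ : ∀ {c n a a′ b b′} → Resolves c n a a′ → Resolves c n b b′ →
                          ValidFrom n a → ValidFrom n b → a <ₗ b → a′ <ₗ b′
  resolves-preserves-<ₗ []          []         _  _  (base ())
  resolves-preserves-<ₗ []          (keep _ _) _  _  halt = halt
  resolves-preserves-<ₗ []          (skip _)   _  _  halt = halt
  resolves-preserves-<ₗ []          hit        _  _  halt = halt
  resolves-preserves-<ₗ (keep _ _)  (keep _ _) _  _  (this e<f) = this e<f
  resolves-preserves-<ₗ (keep _ ra) (keep _ rb) va vb (next refl a<b) =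
    next refl (resolves-preserves-<ₗ ra rb (validFrom-tail va) (validFrom-tail vb) a<b)
  resolves-preserves-<ₗ (keep fin _) (skip _)  _  _  _ = this (finite<ₑinf fin)
  resolves-preserves-<ₗ (keep fin _) hit       va _  _ = this (finite<ₑposition fin va)
  resolves-preserves-<ₗ (skip _)    (keep _ _) _  _  (this ())
  resolves-preserves-<ₗ (skip _)    (keep () _) _ _  (next refl _)
  resolves-preserves-<ₗ (skip _)    (skip _)   _  _  (this ())
  resolves-preserves-<ₗ (skip ra)   (skip rb)  va vb (next refl a<b) =
    next refl (resolves-preserves-<ₗ ra rb (validFrom-tail va) (validFrom-tail vb) a<b)
  resolves-preserves-<ₗ hit         (keep _ _) _  _  (this ())
  resolves-preserves-<ₗ hit         (keep () _) _ _  (next refl _)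
  resolves-preserves-<ₗ hit         hit        _  _  (this ())
  resolves-preserves-<ₗ hit         hit        _  _  (next refl a<b) = next refl a<b

  resolves-reflects-<ₗ : ∀ {c n a a′ b b′} → Resolves c n a a′ → Resolves c n b b′ →
                         ValidFrom n a → ValidFrom n b → a′ <ₗ b′ → a <ₗ b
  resolves-reflects-<ₗ []          []         _  _  (base ())
  resolves-reflects-<ₗ []          (keep _ _) _  _  halt = halt
  resolves-reflects-<ₗ []          (skip _)   _  _  halt = halt
  resolves-reflects-<ₗ []          hit        _  _  halt = halt
  resolves-reflects-<ₗ (keep _ _)  (keep _ _) _  _  (this e<f) = this e<f
  resolves-reflects-<ₗ (keep _ ra) (keep _ rb) va vb (next refl a<b) =
    next refl (resolves-reflects-<ₗ ra rb (validFrom-tail va) (validFrom-tail vb) a<b)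
  resolves-reflects-<ₗ (keep fin _) (skip _)  _  _  _ = this (finite<ₑinf fin)
  resolves-reflects-<ₗ (keep fin _) hit       _  _  _ = this (finite<ₑinf fin)
  resolves-reflects-<ₗ (skip _)    (keep _ _) _  _  (this ())
  resolves-reflects-<ₗ (skip _)    (keep () _) _ _  (next refl _)
  resolves-reflects-<ₗ (skip _)    (skip _)   _  _  (this ())
  resolves-reflects-<ₗ (skip ra)   (skip rb)  va vb (next refl a<b) =
    next refl (resolves-reflects-<ₗ ra rb (validFrom-tail va) (validFrom-tail vb) a<b)
  resolves-reflects-<ₗ hit (keep fin _) _ vb (this n<e) = ⊥-elim (position≮ₑfinite fin vb n<e)
  resolves-reflects-<ₗ hit (keep num _) _ (num n<n _) (next refl _) = ⊥-elim (<-irrefl refl n<n)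
  resolves-reflects-<ₗ hit         hit        _  _  (this n<n) = ⊥-elim (<-irrefl refl n<n)
  resolves-reflects-<ₗ hit         hit        _  _  (next refl a<b) = next refl a<b

  resolves-<ₗ-⇔ : ∀ {c n a a′ b b′} → Resolves c n a a′ → Resolves c n b b′ →
                  ValidFrom n a → ValidFrom n b → a <ₗ b ⇔ a′ <ₗ b′
  resolves-<ₗ-⇔ ra rb va vb = mk⇔ (resolves-preserves-<ₗ ra rb va vb) (resolves-reflects-<ₗ ra rb va vb)

  <ₗ⇔∷<ₗ∷ : ∀ {e a b} → ¬ e <ₑ e → a <ₗ b ⇔ (e ∷ a) <ₗ (e ∷ b)
  <ₗ⇔∷<ₗ∷ e≮e = mk⇔ (next refl) λ { (this e<e) → ⊥-elim (e≮e e<e) ; (next refl a<b) → a<b }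

  -- The number of p-symbols of w, before the first p, that occur neither in r nor earlier in w.
  newBefore : List (S ⊎ P) → P → PStr → ℕ
  newBefore r p []           = 0
  newBefore r p (inj₁ s ∷ w) = newBefore (inj₁ s ∷ r) p w
  newBefore r p (inj₂ q ∷ w) with p ≟ q
  ... | yes _ = 0
  ... | no  _ with dist q r
  ...   | just _  = newBefore (inj₂ q ∷ r) p w
  ...   | nothing = suc (newBefore (inj₂ q ∷ r) p w)

  encAux-resolves : ∀ r p w → dist p r ≡ nothing →
                    Resolves (newBefore r p w) (suc (length r)) (encAux r w) (encAux (r ∷ʳ inj₂ p) w)
  encAux-resolves r p []           _ = []
  encAux-resolves r p (inj₁ s ∷ w) p∉r =
    keep sym (encAux-resolves (inj₁ s ∷ r) p w (cong (Data.Maybe.map suc) p∉r))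
  encAux-resolves r p (inj₂ q ∷ w) p∉r with p ≟ q
  ... | yes refl
    rewrite p∉r | dist-∷ʳ-fresh r p∉r | encAux-cong w {inj₂ p ∷ (r ∷ʳ inj₂ p)} (dist-∷-∷ʳ-shadowed p r)
    = hit
  ... | no p≢q rewrite dist-∷ʳ-≢ r (p≢q ∘ ≡-sym) with dist q r
  ...   | just _  = keep num (encAux-resolves (inj₂ q ∷ r) p w (dist-∷-fresh r p∉r p≢q))
  ...   | nothing = skip (encAux-resolves (inj₂ q ∷ r) p w (dist-∷-fresh r p∉r p≢q))

  SeenSymbols : List P → P → List (S ⊎ P) → Set
  SeenSymbols L p r = ∀ a → a ∈ L ⇔ (a ≡ p ⊎ inj₂ a ∈ r)

  seenSymbols-[] : ∀ p → SeenSymbols [ p ] p []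
  seenSymbols-[] p a = mk⇔ (λ { (here a≡p) → inj₁ a≡p }) λ { (inj₁ a≡p) → here a≡p ; (inj₂ ()) }

  seenSymbols-∷-sSym : ∀ {L p r} s → SeenSymbols L p r → SeenSymbols L p (inj₁ s ∷ r)
  seenSymbols-∷-sSym s seen a =
    mk⇔ (Sum.map₂ there ∘ to (seen a)) (from (seen a) ∘ Sum.map₂ λ { (here ()) ; (there a∈r) → a∈r })

  seenSymbols-∷-pSym : ∀ {L p r} q → SeenSymbols L p r → SeenSymbols (L ∷ʳ q) p (inj₂ q ∷ r)
  seenSymbols-∷-pSym {L} q seen a = mk⇔ seen⁺ seen⁻
    where
    seen⁺ : a ∈ L ∷ʳ q → a ≡ _ ⊎ inj₂ a ∈ inj₂ q ∷ _
    seen⁺ a∈ with ∈-++⁻ L a∈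
    ... | inj₁ a∈L       = Sum.map₂ there (to (seen a) a∈L)
    ... | inj₂ (here refl) = inj₂ (here refl)
    seen⁻ : a ≡ _ ⊎ inj₂ a ∈ inj₂ q ∷ _ → a ∈ L ∷ʳ q
    seen⁻ (inj₁ a≡p)         = ∈-++⁺ˡ (from (seen a) (inj₁ a≡p))
    seen⁻ (inj₂ (here refl)) = ∈-++⁺ʳ L (here refl)
    seen⁻ (inj₂ (there a∈r)) = ∈-++⁺ˡ (from (seen a) (inj₂ a∈r))

  distinct-upToNext : ∀ r p w L → SeenSymbols L p r →
                      distinct _≟_ (L ++ mapMaybe isP (upToNext p w)) ≡ distinct _≟_ L + newBefore r p w

  distinct-∷ʳ-upToNext : ∀ r p q w L → SeenSymbols L p r →
                         distinct _≟_ (L ++ q ∷ mapMaybe isP (upToNext p w))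
                           ≡ distinct _≟_ (L ∷ʳ q) + newBefore (inj₂ q ∷ r) p w
  distinct-upToNext r p []           L seen =
    trans (cong (distinct _≟_) (++-identityʳ L)) (≡-sym (+-identityʳ _))
  distinct-upToNext r p (inj₁ s ∷ w) L seen =
    distinct-upToNext (inj₁ s ∷ r) p w L (seenSymbols-∷-sSym s seen)
  distinct-upToNext r p (inj₂ q ∷ w) L seen with p ≟ q
  ... | yes refl = trans (distinct-∷ʳ-∈ _≟_ L (from (seen p) (inj₁ refl))) (≡-sym (+-identityʳ _))
  ... | no p≢q with dist q r in e
  ...   | just _ = trans (distinct-∷ʳ-upToNext r p q w L seen) (cong (_+ _) (distinct-∷ʳ-∈ _≟_ L q∈L))
    where
    q∈L : q ∈ L
    q∈L = from (seen q) (inj₂ (dist-just⇒∈ r e))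
  ...   | nothing = begin
    distinct _≟_ (L ++ q ∷ rest)          ≡⟨ distinct-∷ʳ-upToNext r p q w L seen ⟩
    distinct _≟_ (L ∷ʳ q) + k             ≡⟨ cong (_+ k) (distinct-∷ʳ-∉ _≟_ L q∉L) ⟩
    suc (distinct _≟_ L) + k              ≡⟨ +-suc (distinct _≟_ L) k ⟨
    distinct _≟_ L + suc k                ∎
    where
    open ≡-Reasoning
    rest : List P
    rest = mapMaybe isP (upToNext p w)
    k : ℕ
    k = newBefore (inj₂ q ∷ r) p w
    q∉L : q ∉ L
    q∉L q∈L = Sum.[ (λ q≡p → p≢q (≡-sym q≡p)) , dist-nothing⇒∉ r e ] (to (seen q) q∈L)

  distinct-∷ʳ-upToNext r p q w L seen =
    trans (cong (distinct _≟_) (≡-sym (∷ʳ-++ L q _)))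
          (distinct-upToNext (inj₂ q ∷ r) p w (L ∷ʳ q) (seenSymbols-∷-pSym q seen))

  fce-∷-pSym : ∀ p w → fce (inj₂ p ∷ w) ≡ fnum (suc (newBefore [] p w))
  fce-∷-pSym p w = cong fnum (distinct-upToNext [] p w [ p ] (seenSymbols-[] p))

  fnum-injective : ∀ {m n} → fnum {S} m ≡ fnum n → m ≡ n
  fnum-injective refl = refl

  ⟨suffix2⟩-<ₗ-⇔ : IsStrictTotalOrder _≡_ _<ₛ_ → ∀ x y → fce x ≡ fce y →
                   ⟨ suffix2 x ⟩ <ₗ ⟨ suffix2 y ⟩ ⇔ ⟨ x ⟩ <ₗ ⟨ y ⟩
  ⟨suffix2⟩-<ₗ-⇔ _ [] [] _ = mk⇔ id id
  ⟨suffix2⟩-<ₗ-⇔ sto (inj₁ s ∷ x) (inj₁ .s ∷ y) refl rewrite ⟨⟩-∷-sSym s x | ⟨⟩-∷-sSym s y =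
    <ₗ⇔∷<ₗ∷ (IsStrictTotalOrder.irrefl sto refl)
  ⟨suffix2⟩-<ₗ-⇔ _ (inj₂ p ∷ x) (inj₂ q ∷ y) fce≡ =
    <ₗ⇔∷<ₗ∷ (λ ()) ⇔-∘ resolves-<ₗ-⇔ resolves-x resolves-y (encAux-valid [] x) (encAux-valid [] y)
    where
    same-count : newBefore [] q y ≡ newBefore [] p x
    same-count = suc-injective (fnum-injective (begin
      fnum (suc (newBefore [] q y)) ≡⟨ fce-∷-pSym q y ⟨
      fce (inj₂ q ∷ y)              ≡⟨ fce≡ ⟨
      fce (inj₂ p ∷ x)              ≡⟨ fce-∷-pSym p x ⟩
      fnum (suc (newBefore [] p x)) ∎))
      where open ≡-Reasoning
    resolves-x : Resolves (newBefore [] p x) 1 ⟨ x ⟩ (encAux [ inj₂ p ] x)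
    resolves-x = encAux-resolves [] p x refl
    resolves-y : Resolves (newBefore [] p x) 1 ⟨ y ⟩ (encAux [ inj₂ q ] y)
    resolves-y = subst (λ c → Resolves c 1 ⟨ y ⟩ (encAux [ inj₂ q ] y)) same-count
                       (encAux-resolves [] q y refl)
  ⟨suffix2⟩-<ₗ-⇔ _ []           (inj₁ _ ∷ _) ()
  ⟨suffix2⟩-<ₗ-⇔ _ []           (inj₂ _ ∷ _) ()
  ⟨suffix2⟩-<ₗ-⇔ _ (inj₁ _ ∷ _) []           ()
  ⟨suffix2⟩-<ₗ-⇔ _ (inj₂ _ ∷ _) []           ()
  ⟨suffix2⟩-<ₗ-⇔ _ (inj₁ _ ∷ _) (inj₂ _ ∷ _) ()
  ⟨suffix2⟩-<ₗ-⇔ _ (inj₂ _ ∷ _) (inj₁ _ ∷ _) ()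

corollary2 : {S P : Set} (_≟_ : DecidableEquality P) (_<ₛ_ : Rel S 0ℓ)
    → IsStrictTotalOrder _≡_ _<ₛ_
    → (x y : List (S ⊎ P))
    → PString.fce _≟_ _<ₛ_ x ≡ PString.fce _≟_ _<ₛ_ y
    → (PString._<ₗ_ _≟_ _<ₛ_ (PString.⟨_⟩ _≟_ _<ₛ_ (PString.suffix2 _≟_ _<ₛ_ x)) (PString.⟨_⟩ _≟_ _<ₛ_ (PString.suffix2 _≟_ _<ₛ_ y))
    ⇔ PString._<ₗ_ _≟_ _<ₛ_ (PString.⟨_⟩ _≟_ _<ₛ_ x) (PString.⟨_⟩ _≟_ _<ₛ_ y))
corollary2 _≟_ _<ₛ_ = ⟨suffix2⟩-<ₗ-⇔ _≟_ _<ₛ_
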